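{- Let $n$ be even and $r \ge 1$. In the vertex-query model on general (not necessarily bipartite) graphs on $n$ vertices, for every (deterministic, adaptive) player strategy using $r$ rounds there is a streaming-consistent oracle against which the player's reported matching has approximation ratio at most $\frac{1}{2} + \frac{r}{n}$.
   Context: Vertex-query model: a player and an oracle play a round-based game on a vertex set $V$ with $|V| = n$, known to both. Over the game the oracle makes up a graph $G = (V,E)$ which must admit a perfect matching. In each round $i = 1,\dots,r$ the player, possibly depending on all previous answers, submits a query $V_i \subseteq V$, and the oracle returns a set of edges $M_i$ that is a maximal matching in the vertex-induced subgraph $G[V_i]$; all answers must be consistent with the single graph $G$. After $r$ rounds the player reports a maximum matching $M_P$ among the edges $\bigcup_{i \le r} M_i$, and the approximation ratio is $|M_P| / (n/2)$. The oracle is streaming-consistent if there is an ordering $\pi$ of $E$ such that for every round $i$, $M_i$ equals the output of the Greedy algorithm (scan edges in order, add an edge whenever both endpoints are currently unmatched) run on the substream of $\pi$ consisting of the edges of $G[V_i]$. -}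

module Defs where

open import Data.Nat using (ℕ; zero; suc)
open import Data.Bool using (Bool; true; false; _∧_; not; if_then_else_)
open import Data.Fin using (Fin; _≟_)
open import Data.Fin.Subset using (Subset)
open import Data.Vec using (lookup)
open import Data.List using (List; []; _∷_; _++_; [_]; concatMap)
open import Data.Bool.ListAction using (any)
open import Data.List.Relation.Unary.All using (All)
open import Data.List.Relation.Unary.Any using (Any)
open import Data.List.Relation.Unary.AllPairs using (AllPairs)
open import Data.List.Relation.Unary.Unique.Propositional using (Unique)
open import Data.List.Membership.Propositional using (_∈_)
open import Data.Product using (_×_; _,_; swap; ∃)
open import Data.Sum using (_⊎_)
open import Relation.Nullary using (¬_)
open import Relation.Nullary.Decidable using (⌊_⌋)
open import Relation.Binary.PropositionalEquality using (_≡_; _≢_)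

Edge : ℕ → Set
Edge n = Fin n × Fin n

SameEdge : ∀ {n} → Edge n → Edge n → Set
SameEdge e f = (e ≡ f) ⊎ (e ≡ swap f)

endpoints : ∀ {n} → List (Edge n) → List (Fin n)
endpoints = concatMap (λ { (u , v) → u ∷ v ∷ [] })

-- A matching: no vertex is an endpoint of two edges (and no loops),
-- i.e. the endpoint list has no repetitions.
IsMatching : ∀ {n} → List (Edge n) → Set
IsMatching M = Unique (endpoints M)

-- An edge ordering π of a simple graph G: loop-free, and no undirected
-- edge appears twice. E(G) is the set of edges listed in π.
IsEdgeOrdering : ∀ {n} → List (Edge n) → Set
IsEdgeOrdering π =
  All (λ e → Data.Product.proj₁ e ≢ Data.Product.proj₂ e) π
  × AllPairs (λ e f → ¬ SameEdge e f) π

_∈E_ : ∀ {n} → Edge n → List (Edge n) → Set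
e ∈E es = Any (SameEdge e) es

HasPerfectMatching : ∀ n → List (Edge n) → Set
HasPerfectMatching n π =
  ∃ λ (M : List (Edge n)) → IsMatching M × All (_∈ π) M × (∀ (v : Fin n) → v ∈ endpoints M)

covered : ∀ {n} → Fin n → List (Edge n) → Bool
covered v acc = any (λ w → ⌊ v ≟ w ⌋) (endpoints acc)

-- Greedy on the substream of π consisting of edges of G[S]:
-- scan in order, add an edge whenever both endpoints are in S and unmatched.
greedyGo : ∀ {n} → Subset n → List (Edge n) → List (Edge n) → List (Edge n)
greedyGo S acc [] = acc
greedyGo S acc ((u , v) ∷ es) =
  if lookup S u ∧ lookup S v ∧ not (covered u acc) ∧ not (covered v acc)
  then greedyGo S (acc ++ [ (u , v) ]) es
  else greedyGo S acc es

greedy : ∀ {n} → List (Edge n) → Subset n → List (Edge n)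
greedy π S = greedyGo S [] π

-- A deterministic adaptive player strategy: the next query V_i ⊆ V as a
-- function of the answers M_1, …, M_{i-1} received so far (in order).
Strategy : ℕ → Set
Strategy n = List (List (Edge n)) → Subset n

-- Run r more rounds of the game against the streaming-consistent oracle
-- given by ordering π, starting from history h; returns the full history.
play : ∀ {n} → Strategy n → List (Edge n) → ℕ → List (List (Edge n)) → List (List (Edge n))
play σ π zero h = h
play σ π (suc r) h = play σ π r (h ++ [ greedy π (σ h) ])

revealed : ∀ {n} → Strategy n → List (Edge n) → ℕ → List (Edge n)
revealed σ π r = Data.List.concat (play σ π r [])

-- Write n = 2k and split the vertices into halves L and R of size k. The oracle's graph is
-- a clique on L plus a perfect matching ("rungs") between L and R, streamed clique first.
-- In every round Greedy on the clique leaves at most one vertex of L ∩ V_i uncovered, so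
-- afterwards at most one rung can be added: each answer touches at most one vertex of R.
-- Hence the revealed edges touch at most r vertices of R, and a matching among them has at
-- most k + r endpoints, i.e. at most (k + r)/2 = n/4 + r/2 edges.

module Submission where

open import Defs
open import Data.Nat using (ℕ; zero; suc; _+_; _*_; _≤_; z≤n; s≤s)
open import Data.Nat.Properties
  using (n≤1+n; ≤-trans; ≤-reflexive; +-suc; +-monoʳ-≤; +-mono-≤; *-monoʳ-≤; module ≤-Reasoning)
open import Data.Nat.Tactic.RingSolver using (solve-∀)
open import Data.Bool using (Bool; true; false; T; not; _∧_)
open import Data.Bool.ListAction using (any)
open import Data.Unit using (tt)
open import Data.Empty using (⊥-elim)
open import Data.Fin using (Fin; _≟_; _↑ˡ_; _↑ʳ_; splitAt; join)
open import Data.Fin.Subset using (Subset)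
open import Data.Fin.Properties using (splitAt-↑ˡ; splitAt-↑ʳ; join-splitAt; ↑ˡ-injective; ↑ʳ-injective)
open import Data.Vec using (lookup)
open import Data.List using (List; []; _∷_; _++_; [_]; length; map; concat; allFin; tabulate; filterᵇ)
open import Data.List.Properties using (length-++; length-tabulate; ++-assoc; ++-identityʳ; filter-++)
open import Data.List.Relation.Unary.All as All using (All; []; _∷_)
import Data.List.Relation.Unary.All.Properties as All
open import Data.List.Relation.Unary.Any using (here; there)
open import Data.List.Relation.Unary.AllPairs as AllPairs using (AllPairs; []; _∷_)
import Data.List.Relation.Unary.AllPairs.Properties as AllPairs
open import Data.List.Relation.Unary.Unique.Propositional using (Unique)
import Data.List.Relation.Unary.Unique.Propositional.Properties as Unique
open import Data.List.Membership.Propositional using (_∈_; _∉_)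
open import Data.List.Membership.Propositional.Properties
  using (∈-map⁺; ∈-map⁻; ∈-++⁺ˡ; ∈-++⁺ʳ; ∈-++⁻; ∈-∃++; ∈-allFin; ∈-tabulate⁺; ∈-tabulate⁻; ∈-filter⁺)
open import Data.Product using (_×_; ∃; _,_; proj₁; proj₂)
open import Data.Sum as Sum using (_⊎_; inj₁; inj₂; [_,_]′)
open import Function using (_∘_; const; case_of_)
open import Relation.Nullary using (¬_; yes; no)
open import Relation.Nullary.Decidable using (⌊_⌋; T?)
open import Relation.Binary.PropositionalEquality
  using (_≡_; _≢_; refl; sym; trans; cong; subst; subst₂; module ≡-Reasoning)

Unique-⊆⇒length≤ : ∀ {A : Set} {xs ys : List A} → Unique xs → (∀ {x} → x ∈ xs → x ∈ ys) →
  length xs ≤ length ys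
Unique-⊆⇒length≤ {xs = []} _ _ = z≤n
Unique-⊆⇒length≤ {xs = x ∷ xs} (x∉xs ∷ u) xs⊆ys with ∈-∃++ (xs⊆ys (here refl))
... | ys₁ , ys₂ , refl = ≤-trans (s≤s (Unique-⊆⇒length≤ u xs⊆ys₁ys₂)) (≤-reflexive length-removed)
  where
  xs⊆ys₁ys₂ : ∀ {z} → z ∈ xs → z ∈ ys₁ ++ ys₂
  xs⊆ys₁ys₂ z∈xs with ∈-++⁻ ys₁ (xs⊆ys (there z∈xs))
  ... | inj₁ z∈ys₁ = ∈-++⁺ˡ z∈ys₁
  ... | inj₂ (here refl) = ⊥-elim (All.lookup x∉xs z∈xs refl)
  ... | inj₂ (there z∈ys₂) = ∈-++⁺ʳ ys₁ z∈ys₂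
  length-removed : 1 + length (ys₁ ++ ys₂) ≡ length (ys₁ ++ x ∷ ys₂)
  length-removed = begin
    1 + length (ys₁ ++ ys₂)          ≡⟨ cong (1 +_) (length-++ ys₁) ⟩
    1 + (length ys₁ + length ys₂)    ≡⟨ sym (+-suc (length ys₁) (length ys₂)) ⟩
    length ys₁ + length (x ∷ ys₂)    ≡⟨ sym (length-++ ys₁) ⟩
    length (ys₁ ++ x ∷ ys₂)          ∎
    where open ≡-Reasoning

module _ {n : ℕ} where

  endpoints-++ : (xs ys : List (Edge n)) → endpoints (xs ++ ys) ≡ endpoints xs ++ endpoints ys
  endpoints-++ [] ys = refl
  endpoints-++ ((u , v) ∷ xs) ys = cong (λ zs → u ∷ v ∷ zs) (endpoints-++ xs ys)

  length-endpoints : (xs : List (Edge n)) → length (endpoints xs) ≡ length xs + length xs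
  length-endpoints [] = refl
  length-endpoints ((u , v) ∷ xs) =
    cong (1 +_) (trans (cong (1 +_) (length-endpoints xs)) (sym (+-suc (length xs) (length xs))))

  ∈-endpoints-++⁺ˡ : ∀ {v} xs ys → v ∈ endpoints xs → v ∈ endpoints (xs ++ ys)
  ∈-endpoints-++⁺ˡ xs ys v∈ rewrite endpoints-++ xs ys = ∈-++⁺ˡ v∈

  ∈-endpoints-++⁺ʳ : ∀ {v} xs {ys} → v ∈ endpoints ys → v ∈ endpoints (xs ++ ys)
  ∈-endpoints-++⁺ʳ xs {ys} v∈ rewrite endpoints-++ xs ys = ∈-++⁺ʳ (endpoints xs) v∈

  ∈E⇒∈-endpoints : ∀ {u v} (es : List (Edge n)) → (u , v) ∈E es →
    u ∈ endpoints es × v ∈ endpoints es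
  ∈E⇒∈-endpoints (_ ∷ es) (here (inj₁ refl)) = here refl , there (here refl)
  ∈E⇒∈-endpoints (_ ∷ es) (here (inj₂ refl)) = there (here refl) , here refl
  ∈E⇒∈-endpoints (_ ∷ es) (there e∈) with ∈E⇒∈-endpoints es e∈
  ... | u∈ , v∈ = there (there u∈) , there (there v∈)

  endpoints-⊆ : ∀ {v} (es M : List (Edge n)) → All (_∈E es) M → v ∈ endpoints M → v ∈ endpoints es
  endpoints-⊆ es (_ ∷ M) (e∈ ∷ _) (here refl) = proj₁ (∈E⇒∈-endpoints es e∈)
  endpoints-⊆ es (_ ∷ M) (e∈ ∷ _) (there (here refl)) = proj₂ (∈E⇒∈-endpoints es e∈)
  endpoints-⊆ es (_ ∷ M) (_ ∷ M⊆) (there (there v∈)) = endpoints-⊆ es M M⊆ v∈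

  covered⇒∈ : ∀ v (acc : List (Edge n)) → covered v acc ≡ true → v ∈ endpoints acc
  covered⇒∈ v acc = any≟⇒∈ (endpoints acc)
    where
    any≟⇒∈ : ∀ ws → any (λ w → ⌊ v ≟ w ⌋) ws ≡ true → v ∈ ws
    any≟⇒∈ (w ∷ ws) found with v ≟ w
    ... | yes v≡w = here v≡w
    ... | no _ = there (any≟⇒∈ ws found)

  ∈⇒covered : ∀ {v} (acc : List (Edge n)) → v ∈ endpoints acc → covered v acc ≡ true
  ∈⇒covered {v} acc = ∈⇒any≟ (endpoints acc)
    where
    ∈⇒any≟ : ∀ ws → v ∈ ws → any (λ w → ⌊ v ≟ w ⌋) ws ≡ true
    ∈⇒any≟ (w ∷ ws) v∈ with v ≟ w | v∈
    ... | yes _ | _ = refl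
    ... | no v≢w | here v≡w = ⊥-elim (v≢w v≡w)
    ... | no _ | there v∈ws = ∈⇒any≟ ws v∈ws

module _ {n : ℕ} (S : Subset n) where

  -- The guard of greedyGo; 'with admissible acc e' abstracts it in unfoldings of greedyGo.
  admissible : List (Edge n) → Edge n → Bool
  admissible acc (u , v) = lookup S u ∧ lookup S v ∧ not (covered u acc) ∧ not (covered v acc)

  admissible⇒ : ∀ acc {u v} → admissible acc (u , v) ≡ true → lookup S u ≡ true × u ∉ endpoints acc
  admissible⇒ acc {u} {v} adm with lookup S u | lookup S v | covered u acc in cu | covered v acc
  ... | true | true | false | false = refl , λ u∈ → case trans (sym (∈⇒covered acc u∈)) cu of λ ()

  admissible-false⇒covered : ∀ acc {u v} → lookup S u ≡ true → lookup S v ≡ true →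
    admissible acc (u , v) ≡ false → u ∈ endpoints acc ⊎ v ∈ endpoints acc
  admissible-false⇒covered acc {u} {v} su sv adm
    with lookup S u | lookup S v | covered u acc in cu | covered v acc in cv
  ... | true | true | true | _ = inj₁ (covered⇒∈ u acc cu)
  ... | true | true | false | true = inj₂ (covered⇒∈ v acc cv)

  greedyGo-extends : ∀ acc es → ∃ λ ys → greedyGo S acc es ≡ acc ++ ys
  greedyGo-extends acc [] = [] , sym (++-identityʳ acc)
  greedyGo-extends acc (e ∷ es) with admissible acc e
  ... | false = greedyGo-extends acc es
  ... | true with greedyGo-extends (acc ++ [ e ]) es
  ...   | ys , eq = e ∷ ys , trans eq (++-assoc acc [ e ] ys)

  greedyGo-++ : ∀ acc es fs → greedyGo S acc (es ++ fs) ≡ greedyGo S (greedyGo S acc es) fs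
  greedyGo-++ acc [] fs = refl
  greedyGo-++ acc (e ∷ es) fs with admissible acc e
  ... | true = greedyGo-++ (acc ++ [ e ]) es fs
  ... | false = greedyGo-++ acc es fs

  greedyGo-All : ∀ {P : Edge n → Set} acc es → All P acc → All P es → All P (greedyGo S acc es)
  greedyGo-All acc [] Pacc [] = Pacc
  greedyGo-All acc (e ∷ es) Pacc (Pe ∷ Pes) with admissible acc e
  ... | true = greedyGo-All (acc ++ [ e ]) es (All.++⁺ Pacc (Pe ∷ [])) Pes
  ... | false = greedyGo-All acc es Pacc Pes

  ∈-endpoints-greedyGo : ∀ {v} acc es → v ∈ endpoints acc → v ∈ endpoints (greedyGo S acc es)
  ∈-endpoints-greedyGo acc es v∈ with greedyGo-extends acc es
  ... | ys , eq rewrite eq = ∈-endpoints-++⁺ˡ acc ys v∈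

  greedyGo-maximal : ∀ acc es {u v} → (u , v) ∈ es → lookup S u ≡ true → lookup S v ≡ true →
    u ∈ endpoints (greedyGo S acc es) ⊎ v ∈ endpoints (greedyGo S acc es)
  greedyGo-maximal acc ((u , v) ∷ es) (here refl) su sv with admissible acc (u , v) in adm
  ... | true = inj₁ (∈-endpoints-greedyGo (acc ++ [ (u , v) ]) es (∈-endpoints-++⁺ʳ acc (here refl)))
  ... | false = Sum.map (∈-endpoints-greedyGo acc es) (∈-endpoints-greedyGo acc es)
                        (admissible-false⇒covered acc su sv adm)
  greedyGo-maximal acc (e ∷ es) (there e∈) su sv with admissible acc e
  ... | true = greedyGo-maximal (acc ++ [ e ]) es e∈ su sv
  ... | false = greedyGo-maximal acc es e∈ su sv

  Covers : (Fin n → Set) → List (Edge n) → Set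
  Covers X acc = ∀ {x} → X x → lookup S x ≡ true → x ∈ endpoints acc

  CoversAllButOne : (Fin n → Set) → List (Edge n) → Set
  CoversAllButOne X acc = ∀ {x y} → X x → X y → lookup S x ≡ true → lookup S y ≡ true → x ≢ y →
    x ∈ endpoints acc ⊎ y ∈ endpoints acc

  greedyGo-idle : ∀ {X} acc es → Covers X acc → All (X ∘ proj₁) es → greedyGo S acc es ≡ acc
  greedyGo-idle acc [] _ [] = refl
  greedyGo-idle acc (e ∷ es) cov (Xu ∷ Xes) with admissible acc e in adm
  ... | false = greedyGo-idle acc es cov Xes
  ... | true = ⊥-elim (u∉ (cov Xu su))
    where
    su = proj₁ (admissible⇒ acc adm)
    u∉ = proj₂ (admissible⇒ acc adm)

  -- The first edge added covers the single uncovered vertex of X ∩ S; then greedyGo-idle applies.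
  greedyGo-addsAtMostOne : ∀ {X} acc es → CoversAllButOne X acc → All (X ∘ proj₁) es →
    ∃ λ ys → greedyGo S acc es ≡ acc ++ ys × length ys ≤ 1
  greedyGo-addsAtMostOne acc [] _ [] = [] , sym (++-identityʳ acc) , z≤n
  greedyGo-addsAtMostOne {X} acc ((u , v) ∷ es) cov (Xu ∷ Xes) with admissible acc (u , v) in adm
  ... | false = greedyGo-addsAtMostOne acc es cov Xes
  ... | true = [ (u , v) ] , greedyGo-idle (acc ++ [ (u , v) ]) es covers Xes , s≤s z≤n
    where
    su = proj₁ (admissible⇒ acc adm)
    u∉ = proj₂ (admissible⇒ acc adm)
    covers : Covers X (acc ++ [ (u , v) ])
    covers {x} Xx sx with x ≟ u
    ... | yes refl = ∈-endpoints-++⁺ʳ acc (here refl)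
    ... | no x≢u =
      [ ∈-endpoints-++⁺ˡ acc [ (u , v) ] , (λ u∈ → ⊥-elim (u∉ u∈)) ]′ (cov Xx Xu sx su x≢u)

pairs : ∀ {A : Set} → List A → List (A × A)
pairs [] = []
pairs (x ∷ xs) = map (x ,_) xs ++ pairs xs

module _ {A : Set} where

  ∈-pairs⁻ : ∀ xs {u v : A} → (u , v) ∈ pairs xs → u ∈ xs × v ∈ xs
  ∈-pairs⁻ (x ∷ xs) e∈ with ∈-++⁻ (map (x ,_) xs) e∈
  ... | inj₁ e∈head with ∈-map⁻ (x ,_) e∈head
  ...   | _ , v∈ , refl = here refl , there v∈
  ∈-pairs⁻ (x ∷ xs) e∈ | inj₂ e∈tail with ∈-pairs⁻ xs e∈tail
  ...   | u∈ , v∈ = there u∈ , there v∈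

  ∈-pairs⁺ : ∀ {xs} {u v : A} → u ∈ xs → v ∈ xs → u ≢ v →
    (u , v) ∈ pairs xs ⊎ (v , u) ∈ pairs xs
  ∈-pairs⁺ (here refl) (here refl) u≢v = ⊥-elim (u≢v refl)
  ∈-pairs⁺ {x ∷ xs} (here refl) (there v∈) _ = inj₁ (∈-++⁺ˡ (∈-map⁺ (x ,_) v∈))
  ∈-pairs⁺ {x ∷ xs} (there u∈) (here refl) _ = inj₂ (∈-++⁺ˡ (∈-map⁺ (x ,_) u∈))
  ∈-pairs⁺ {x ∷ xs} (there u∈) (there v∈) u≢v =
    Sum.map (∈-++⁺ʳ (map (x ,_) xs)) (∈-++⁺ʳ (map (x ,_) xs)) (∈-pairs⁺ u∈ v∈ u≢v)

module _ {n : ℕ} where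

  pairs-loopFree : ∀ {xs : List (Fin n)} → Unique xs → All (λ e → proj₁ e ≢ proj₂ e) (pairs xs)
  pairs-loopFree [] = []
  pairs-loopFree (x∉xs ∷ u) = All.++⁺ (All.map⁺ x∉xs) (pairs-loopFree u)

  pairs-distinct : ∀ {xs : List (Fin n)} → Unique xs → AllPairs (λ e f → ¬ SameEdge e f) (pairs xs)
  pairs-distinct [] = []
  pairs-distinct {x ∷ xs} (x∉xs ∷ u) = AllPairs.++⁺ (AllPairs.map⁺ (AllPairs.map sameHead u))
    (pairs-distinct u) (All.tabulate λ e∈ → All.tabulate λ f∈ → headVsTail e∈ f∈)
    where
    sameHead : ∀ {y z} → y ≢ z → ¬ SameEdge (x , y) (x , z)
    sameHead y≢z (inj₁ refl) = y≢z refl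
    sameHead y≢z (inj₂ refl) = y≢z refl
    headVsTail : ∀ {e f} → e ∈ map (x ,_) xs → f ∈ pairs xs → ¬ SameEdge e f
    headVsTail {f = c , d} e∈ f∈ same with ∈-map⁻ (x ,_) e∈ | ∈-pairs⁻ xs f∈ | same
    ... | _ , _ , refl | c∈ , _ | inj₁ refl = All.lookup x∉xs c∈ refl
    ... | _ , _ , refl | _ , d∈ | inj₂ refl = All.lookup x∉xs d∈ refl

play-answers : ∀ {n} (σ : Strategy n) π r h →
  ∃ λ Ss → play σ π r h ≡ h ++ map (greedy π) Ss × length Ss ≡ r
play-answers σ π zero h = [] , sym (++-identityʳ h) , refl
play-answers σ π (suc r) h with play-answers σ π r (h ++ [ greedy π (σ h) ])
... | Ss , eq , len = σ h ∷ Ss , trans eq (++-assoc h _ _) , cong suc len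

module HardInstance (k : ℕ) where

  N : ℕ
  N = k + k

  left right : Fin k → Fin N
  left i = i ↑ˡ k
  right i = k ↑ʳ i

  isRight : Fin N → Bool
  isRight v = [ const false , const true ]′ (splitAt k v)

  isRight-left : ∀ i → isRight (left i) ≡ false
  isRight-left i rewrite splitAt-↑ˡ k i k = refl

  isRight-right : ∀ i → isRight (right i) ≡ true
  isRight-right i rewrite splitAt-↑ʳ k k i = refl

  left≢right : ∀ i j → left i ≢ right j
  left≢right i j eq with trans (sym (isRight-left i)) (trans (cong isRight eq) (isRight-right j))
  ... | ()

  IsLeft : Fin N → Set
  IsLeft v = ∃ λ i → v ≡ left i

  left-or-right : ∀ v → IsLeft v ⊎ ∃ λ i → v ≡ right i
  left-or-right v with splitAt k v in eq
  ... | inj₁ i = inj₁ (i , trans (sym (join-splitAt k k v)) (cong (join k k) eq))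
  ... | inj₂ i = inj₂ (i , trans (sym (join-splitAt k k v)) (cong (join k k) eq))

  lefts : List (Fin N)
  lefts = tabulate left

  lefts-unique : Unique lefts
  lefts-unique = Unique.tabulate⁺ (↑ˡ-injective k _ _)

  rung : Fin k → Edge N
  rung i = left i , right i

  clique rungs π : List (Edge N)
  clique = pairs lefts
  rungs = map rung (allFin k)
  π = clique ++ rungs

  ∈-lefts⇒≢right : ∀ {v} → v ∈ lefts → ∀ i → v ≢ right i
  ∈-lefts⇒≢right v∈ i with ∈-tabulate⁻ v∈
  ... | j , refl = left≢right j i

  ∈-endpoints-rungs⁻ : ∀ l {v} → v ∈ endpoints (map rung l) →
    ∃ λ j → j ∈ l × (v ≡ left j ⊎ v ≡ right j)
  ∈-endpoints-rungs⁻ (i ∷ l) (here refl) = i , here refl , inj₁ refl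
  ∈-endpoints-rungs⁻ (i ∷ l) (there (here refl)) = i , here refl , inj₂ refl
  ∈-endpoints-rungs⁻ (i ∷ l) (there (there v∈)) with ∈-endpoints-rungs⁻ l v∈
  ... | j , j∈ , v≡ = j , there j∈ , v≡

  ∈-endpoints-rungs⁺ : ∀ {l i} → i ∈ l →
    left i ∈ endpoints (map rung l) × right i ∈ endpoints (map rung l)
  ∈-endpoints-rungs⁺ (here refl) = here refl , there (here refl)
  ∈-endpoints-rungs⁺ (there i∈) with ∈-endpoints-rungs⁺ i∈
  ... | l∈ , r∈ = there (there l∈) , there (there r∈)

  rungs-isMatching : ∀ {l} → Unique l → IsMatching (map rung l)
  rungs-isMatching [] = []
  rungs-isMatching {i ∷ l} (i∉l ∷ u) =
    (left≢right i i ∷ All.tabulate left∉) ∷ All.tabulate right∉ ∷ rungs-isMatching u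
    where
    left∉ : ∀ {v} → v ∈ endpoints (map rung l) → left i ≢ v
    left∉ v∈ eq with ∈-endpoints-rungs⁻ l v∈
    ... | j , j∈ , inj₁ refl = All.lookup i∉l j∈ (↑ˡ-injective k i j eq)
    ... | j , j∈ , inj₂ refl = left≢right i j eq
    right∉ : ∀ {v} → v ∈ endpoints (map rung l) → right i ≢ v
    right∉ v∈ eq with ∈-endpoints-rungs⁻ l v∈
    ... | j , j∈ , inj₁ refl = left≢right j i (sym eq)
    ... | j , j∈ , inj₂ refl = All.lookup i∉l j∈ (↑ʳ-injective k i j eq)

  π-hasPerfectMatching : HasPerfectMatching N π
  π-hasPerfectMatching =
    rungs , rungs-isMatching (Unique.allFin⁺ k) , All.tabulate (∈-++⁺ʳ clique) , coversAll
    where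
    coversAll : ∀ v → v ∈ endpoints rungs
    coversAll v with left-or-right v
    ... | inj₁ (i , refl) = proj₁ (∈-endpoints-rungs⁺ (∈-allFin i))
    ... | inj₂ (i , refl) = proj₂ (∈-endpoints-rungs⁺ (∈-allFin i))

  π-isEdgeOrdering : IsEdgeOrdering π
  π-isEdgeOrdering =
    All.++⁺ (pairs-loopFree lefts-unique) (All.map⁺ (All.universal (λ i → left≢right i i) (allFin k))) ,
    AllPairs.++⁺ (pairs-distinct lefts-unique) (AllPairs.map⁺ (AllPairs.map distinctRungs (Unique.allFin⁺ k)))
      (All.tabulate λ e∈ → All.tabulate λ f∈ → cliqueVsRung e∈ f∈)
    where
    distinctRungs : ∀ {i j} → i ≢ j → ¬ SameEdge (rung i) (rung j)
    distinctRungs {i} {j} i≢j (inj₁ eq) = i≢j (↑ˡ-injective k i j (cong proj₁ eq))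
    distinctRungs {i} {j} _ (inj₂ eq) = left≢right i j (cong proj₁ eq)
    cliqueVsRung : ∀ {e f} → e ∈ clique → f ∈ rungs → ¬ SameEdge e f
    cliqueVsRung {c , d} e∈ f∈ same with ∈-pairs⁻ lefts e∈ | ∈-map⁻ rung f∈ | same
    ... | _ , d∈ | i , _ , refl | inj₁ eq = ∈-lefts⇒≢right d∈ i (cong proj₂ eq)
    ... | c∈ , _ | i , _ , refl | inj₂ eq = ∈-lefts⇒≢right c∈ i (cong proj₁ eq)

  #rightEnds : List (Edge N) → ℕ
  #rightEnds es = length (filterᵇ isRight (endpoints es))

  #rightEnds-++ : ∀ xs ys → #rightEnds (xs ++ ys) ≡ #rightEnds xs + #rightEnds ys
  #rightEnds-++ xs ys rewrite endpoints-++ xs ys | filter-++ (T? ∘ isRight) (endpoints xs) (endpoints ys) =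
    length-++ (filterᵇ isRight (endpoints xs))

  #rightEnds≤length : ∀ es → All (IsLeft ∘ proj₁) es → #rightEnds es ≤ length es
  #rightEnds≤length [] [] = z≤n
  #rightEnds≤length ((_ , v) ∷ es) ((i , refl) ∷ leftFirst) rewrite isRight-left i with isRight v
  ... | true = s≤s (#rightEnds≤length es leftFirst)
  ... | false = ≤-trans (#rightEnds≤length es leftFirst) (n≤1+n (length es))

  #rightEnds-inLefts : ∀ es → All (λ e → IsLeft (proj₁ e) × IsLeft (proj₂ e)) es → #rightEnds es ≡ 0
  #rightEnds-inLefts [] [] = refl
  #rightEnds-inLefts (_ ∷ es) (((i , refl) , (j , refl)) ∷ inLefts)
    rewrite isRight-left i | isRight-left j = #rightEnds-inLefts es inLefts

  clique-inLefts : All (λ e → IsLeft (proj₁ e) × IsLeft (proj₂ e)) clique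
  clique-inLefts = All.tabulate λ e∈ →
    ∈-tabulate⁻ (proj₁ (∈-pairs⁻ lefts e∈)) , ∈-tabulate⁻ (proj₂ (∈-pairs⁻ lefts e∈))

  greedy-clique-coversAllButOne : ∀ S → CoversAllButOne S IsLeft (greedyGo S [] clique)
  greedy-clique-coversAllButOne S (i , refl) (j , refl) si sj i≢j
    with ∈-pairs⁺ (∈-tabulate⁺ i) (∈-tabulate⁺ j) i≢j
  ... | inj₁ e∈ = greedyGo-maximal S [] clique e∈ si sj
  ... | inj₂ e∈ = Sum.swap (greedyGo-maximal S [] clique e∈ sj si)

  #rightEnds-greedy≤1 : ∀ S → #rightEnds (greedy π S) ≤ 1
  #rightEnds-greedy≤1 S =
    afterRungs (greedyGo-addsAtMostOne S acc₀ rungs (greedy-clique-coversAllButOne S) rungs-leftFirst)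
    where
    open ≤-Reasoning
    acc₀ = greedyGo S [] clique
    acc₀-inLefts : All (λ e → IsLeft (proj₁ e) × IsLeft (proj₂ e)) acc₀
    acc₀-inLefts = greedyGo-All S [] clique [] clique-inLefts
    rungs-leftFirst : All (IsLeft ∘ proj₁) rungs
    rungs-leftFirst = All.map⁺ (All.universal (λ i → i , refl) (allFin k))
    afterRungs : (∃ λ ys → greedyGo S acc₀ rungs ≡ acc₀ ++ ys × length ys ≤ 1) →
      #rightEnds (greedy π S) ≤ 1
    afterRungs (ys , eq , |ys|≤1) = begin
      #rightEnds (greedy π S)          ≡⟨ cong #rightEnds (trans (greedyGo-++ S [] clique rungs) eq) ⟩
      #rightEnds (acc₀ ++ ys)          ≡⟨ #rightEnds-++ acc₀ ys ⟩
      #rightEnds acc₀ + #rightEnds ys  ≡⟨ cong (_+ #rightEnds ys) (#rightEnds-inLefts acc₀ acc₀-inLefts) ⟩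
      #rightEnds ys                    ≤⟨ #rightEnds≤length ys ys-leftFirst ⟩
      length ys                        ≤⟨ |ys|≤1 ⟩
      1                                ∎
      where
      ys-leftFirst : All (IsLeft ∘ proj₁) ys
      ys-leftFirst = All.++⁻ʳ acc₀ (subst (All (IsLeft ∘ proj₁)) eq
        (greedyGo-All S acc₀ rungs (All.map proj₁ acc₀-inLefts) rungs-leftFirst))

  #rightEnds-revealed : ∀ (σ : Strategy N) r → #rightEnds (revealed σ π r) ≤ r
  #rightEnds-revealed σ r with play-answers σ π r []
  ... | Ss , eq , refl rewrite eq = #rightEnds-answers Ss
    where
    #rightEnds-answers : ∀ Ss → #rightEnds (concat (map (greedy π) Ss)) ≤ length Ss
    #rightEnds-answers [] = z≤n
    #rightEnds-answers (S ∷ Ss) = begin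
      #rightEnds (greedy π S ++ concat (map (greedy π) Ss))
        ≡⟨ #rightEnds-++ (greedy π S) _ ⟩
      #rightEnds (greedy π S) + #rightEnds (concat (map (greedy π) Ss))
        ≤⟨ +-mono-≤ (#rightEnds-greedy≤1 S) (#rightEnds-answers Ss) ⟩
      1 + length Ss
        ∎
      where open ≤-Reasoning

  matching-bound : ∀ R M → IsMatching M → All (_∈E R) M → length M + length M ≤ k + #rightEnds R
  matching-bound R M M-matching M⊆R = begin
    length M + length M                               ≡⟨ sym (length-endpoints M) ⟩
    length (endpoints M)                              ≤⟨ Unique-⊆⇒length≤ M-matching endsM⊆ ⟩
    length (lefts ++ filterᵇ isRight (endpoints R))   ≡⟨ length-++ lefts ⟩
    length lefts + #rightEnds R                       ≡⟨ cong (_+ #rightEnds R) (length-tabulate left) ⟩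
    k + #rightEnds R                                  ∎
    where
    open ≤-Reasoning
    endsM⊆ : ∀ {v} → v ∈ endpoints M → v ∈ lefts ++ filterᵇ isRight (endpoints R)
    endsM⊆ {v} v∈ with left-or-right v
    ... | inj₁ (i , refl) = ∈-++⁺ˡ (∈-tabulate⁺ i)
    ... | inj₂ (i , refl) = ∈-++⁺ʳ lefts
      (∈-filter⁺ (T? ∘ isRight) (endpoints-⊆ R M M⊆R v∈) (subst T (sym (isRight-right i)) tt))

  revealed-matching-bound : ∀ (σ : Strategy N) r M → IsMatching M → All (_∈E revealed σ π r) M →
    length M + length M ≤ k + r
  revealed-matching-bound σ r M M-matching M⊆revealed =
    ≤-trans (matching-bound _ M M-matching M⊆revealed) (+-monoʳ-≤ k (#rightEnds-revealed σ r))

m+m≡2*m : ∀ m → m + m ≡ 2 * m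
m+m≡2*m = solve-∀

double-≤ : ∀ m a b → m + m ≤ a + b → 4 * m ≤ (a + a) + 2 * b
double-≤ m a b m+m≤a+b = subst₂ _≤_ (twice-double m) (twice-+ a b) (*-monoʳ-≤ 2 m+m≤a+b)
  where
  twice-double : ∀ m → 2 * (m + m) ≡ 4 * m
  twice-double = solve-∀
  twice-+ : ∀ a b → 2 * (a + b) ≡ (a + a) + 2 * b
  twice-+ = solve-∀

mainTheorem6 : (n r : ℕ) → (∃ λ k → n ≡ 2 * k) → 1 ≤ r → (σ : Strategy n) →
    ∃ λ (π : List (Edge n)) → IsEdgeOrdering π × HasPerfectMatching n π
    × (∀ (M : List (Edge n)) → IsMatching M → All (_∈E revealed σ π r) M →
    4 * length M ≤ n + 2 * r)
mainTheorem6 .(2 * k) r (k , refl) _ rewrite sym (m+m≡2*m k) = λ σ →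
  π , π-isEdgeOrdering , π-hasPerfectMatching ,
  λ M M-matching M⊆revealed → double-≤ (length M) k r (revealed-matching-bound σ r M M-matching M⊆revealed)
  where
  open HardInstance k
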